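{- Let $m\ge 2$ and $n\ge 1$ be integers, let $T_m$ be the infinite $m$-regular tree and let $v$ be a vertex of $T_m$. Then the number $a_n$ of closed walks of length $2n$ on $T_m$ starting at $v$ is \[ a_n = m^{2n} - \sum_{i=1}^{n} \frac{m^{1+2(n-i)}(m-1)^{i}}{4i-2}\binom{2i}{i}. \]
   Context: $T_m$ is the infinite (unrooted) tree in which every vertex has degree $m$. A walk of length $2n$ starting at $v$ is a sequence of vertices $v=x_0,x_1,\dots,x_{2n}$ with $x_{k-1}x_k$ an edge for each $k$; it is closed if $x_{2n}=x_0$. -}

module Defs where

open import Data.Nat using (ℕ; zero; suc; _+_; _*_; _∸_; _^_)
open import Data.Nat.DivMod using (_/_)
open import Data.Nat.Combinatorics using (_C_)
open import Data.Fin using (Fin)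
open import Data.Fin.Properties using () renaming (_≟_ to _≟ᶠ_)
open import Data.List using (List; []; _∷_)
open import Data.List.Properties using (≡-dec)
open import Data.Bool using (Bool; true; false; _∧_; _∨_; not; T)
open import Data.Product using (Σ; proj₁)
open import Relation.Nullary.Decidable using (⌊_⌋)

-- The m-regular tree T_m, realised as the Cayley graph of the free product of
-- m copies of Z/2: vertices are reduced words over the alphabet Fin m (no two
-- consecutive letters equal); w and a ∷ w are adjacent.

reduced : {m : ℕ} → List (Fin m) → Bool
reduced []           = true
reduced (a ∷ [])     = true
reduced (a ∷ b ∷ w)  = not ⌊ a ≟ᶠ b ⌋ ∧ reduced (b ∷ w)

Vertex : ℕ → Set
Vertex m = Σ (List (Fin m)) (λ w → T (reduced w))

isChild : {m : ℕ} → List (Fin m) → List (Fin m) → Bool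
isChild []      x = false
isChild (a ∷ y) x = ⌊ ≡-dec _≟ᶠ_ y x ⌋

adjWord : {m : ℕ} → List (Fin m) → List (Fin m) → Bool
adjWord x y = isChild y x ∨ isChild x y

Adj : {m : ℕ} → Vertex m → Vertex m → Set
Adj x y = T (adjWord (proj₁ x) (proj₁ y))

data Walk {m : ℕ} (x : Vertex m) : ℕ → Vertex m → Set where
  stop : Walk x zero x
  step : {k : ℕ} {y z : Vertex m} → Adj x y → Walk y k z → Walk x (suc k) z

ClosedWalk : (m : ℕ) → Vertex m → ℕ → Set
ClosedWalk m v n = Walk v (2 * n) v

sum₁ : ℕ → (ℕ → ℕ) → ℕ
sum₁ zero    f = 0
sum₁ (suc n) f = sum₁ n f + f (suc n)

-- summand  m^{1+2(n-i)} (m-1)^i binom(2i,i) / (4i-2)   (for i ≥ 1; note 4(j+1)-2 = 2 + 4j)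
-- The division is exact in ℕ (the quotient binom(2i,i)/(4i-2) is the Catalan number C_{i-1}).
summand : ℕ → ℕ → ℕ → ℕ
summand m n zero    = 0
summand m n (suc j) =
  (m ^ (1 + 2 * (n ∸ suc j)) * (m ∸ 1) ^ suc j * ((2 * suc j) C suc j)) / (2 + 4 * j)

formula : ℕ → ℕ → ℕ
formula m n = m ^ (2 * n) ∸ sum₁ n (summand m n)

-- T_m is the Cayley graph of the free product of m copies of ℤ/2, and we write m = q + 1:
-- the neighbours of a reduced word x are the words a ∙ x, one for each letter a.  Right
-- multiplication by v⁻¹ commutes with these moves and sends v to the empty word, so the number
-- of walks of length k from x to v is a function  walks k d  of the distance d from x to v, with
-- walks (k+1) 0 = m · walks k 1  and  walks (k+1) (d+1) = walks k d + q · walks k (d+2).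
-- Comparing with the counts  rootedWalks k d  in the rooted tree whose root has only q children
-- gives  walks k d = walks k (d+2) + rootedWalks k d, hence the first-return recurrence
-- walks (2n+2) 0 = m² · walks (2n) 0 − m q · rootedWalks (2n) 0.  The ballot formula gives
-- rootedWalks (2j) 0 = q^j · Cat j, where Cat j = C(2j,j) − C(2j,j+1) = C(2j+2,j+1)/(4j+2), and
-- unrolling the recurrence yields the formula.

module Submission where

open import Defs
open import Data.Nat using (ℕ; zero; suc; _+_; _*_; _∸_; _^_; _<_; _≤_; z≤n; s≤s)
open import Data.Nat.Properties
  using ( suc-injective; +-suc; +-assoc; +-identityʳ; *-identityʳ; *-zeroʳ; *-assoc; *-suc
        ; *-distribˡ-+; *-distribˡ-∸; *-cancelˡ-≡; m+n∸n≡m; m+n∸m≡n; +-∸-assoc; n∸n≡0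
        ; ≤-refl; m≤m+n; m≤n⇒m≤1+n; n<1+n; m<n⇒m<1+n; m≢1+n+m
        ; *-commutativeSemigroup; +-0-commutativeMonoid )
open import Algebra.Properties.CommutativeSemigroup *-commutativeSemigroup using (x∙yz≈y∙xz; x∙yz≈xz∙y)
open import Data.Nat.DivMod using (_/_; m*n/n≡m)
open import Data.Nat.Combinatorics using (_C_; nC1≡n; nCk≡nC[n∸k]; nCk+nC[k+1]≡[n+1]C[k+1])
open import Data.Nat.Combinatorics.Specification using (k>n⇒nCk≡0)
open import Data.Nat.Tactic.RingSolver using (solve-∀)
open import Data.Fin using (Fin; zero; suc; punchIn)
open import Data.Fin.Properties using (_≟_; punchInᵢ≢i; +↔⊎)
open import Data.List using (List; []; _∷_; foldr; reverse; _ʳ++_; length)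
open import Data.List.Properties using (≡-dec; reverse-injective; ∷-injectiveˡ)
open import Data.Bool using (T)
open import Data.Bool.Properties using (T-irrelevant; T-∨)
open import Data.Product using (Σ; ∃-syntax; _,_; proj₁; proj₂)
open import Data.Sum using (_⊎_; inj₁; inj₂)
open import Data.Unit using (tt)
open import Data.Empty using (⊥-elim)
open import Relation.Nullary using (yes; no)
open import Relation.Nullary.Decidable using (toWitness; fromWitness; map′)
open import Relation.Binary.Definitions using (DecidableEquality)
open import Relation.Binary.PropositionalEquality
open import Function.Base using (_∘_)
open import Function.Bundles using (_↔_; mk↔ₛ′; Equivalence)
open import Function.Properties.Inverse using (↔-refl; ↔-sym; ↔-trans)
open import Data.Product.Function.Dependent.Propositional using (Σ-↔)
open import Data.Sum.Function.Propositional using (_⊎-↔_)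
open import Algebra.Properties.CommutativeMonoid.Sum +-0-commutativeMonoid using (sum; sum-remove; sum-cong-≗)
import Axiom.UniquenessOfIdentityProofs as UIP

open ≡-Reasoning

C-sym : ∀ {n} a b → a + b ≡ n → n C a ≡ n C b
C-sym a b refl = trans (nCk≡nC[n∸k] (m≤m+n a b)) (cong ((a + b) C_) (m+n∸m≡n a b))

[k+1]*[n+1]C[k+1]≡[n+1]*nCk : ∀ n k → suc k * (suc n C suc k) ≡ suc n * (n C k)
[k+1]*[n+1]C[k+1]≡[n+1]*nCk zero    zero    = refl
[k+1]*[n+1]C[k+1]≡[n+1]*nCk zero    (suc k) =
  trans (cong ((2 + k) *_) (k>n⇒nCk≡0 {1} {2 + k} (s≤s (s≤s z≤n)))) (*-zeroʳ (2 + k))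
[k+1]*[n+1]C[k+1]≡[n+1]*nCk (suc n) zero    =
  trans (+-identityʳ ((2 + n) C 1)) (trans (nC1≡n (2 + n)) (sym (*-identityʳ (2 + n))))
[k+1]*[n+1]C[k+1]≡[n+1]*nCk (suc n) (suc k) = begin
  suc (suc k) * (suc (suc n) C suc (suc k))
    ≡⟨ cong (suc (suc k) *_) (nCk+nC[k+1]≡[n+1]C[k+1] (suc n) (suc k)) ⟨
  suc (suc k) * (suc n C suc k + suc n C suc (suc k))
    ≡⟨ shuffle k (suc n C suc k) (suc n C suc (suc k)) ⟩
  suc n C suc k + (suc k * (suc n C suc k) + suc (suc k) * (suc n C suc (suc k)))
    ≡⟨ cong (suc n C suc k +_) (cong₂ _+_ (absorb k) (absorb (suc k))) ⟩
  suc n C suc k + (suc n * (n C k) + suc n * (n C suc k))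
    ≡⟨ cong (suc n C suc k +_) (*-distribˡ-+ (suc n) (n C k) (n C suc k)) ⟨
  suc n C suc k + suc n * (n C k + n C suc k)
    ≡⟨ cong (λ c → suc n C suc k + suc n * c) (nCk+nC[k+1]≡[n+1]C[k+1] n k) ⟩
  suc (suc n) * (suc n C suc k) ∎
  where
  absorb : ∀ k → suc k * (suc n C suc k) ≡ suc n * (n C k)
  absorb = [k+1]*[n+1]C[k+1]≡[n+1]*nCk n
  shuffle : ∀ k a b → suc (suc k) * (a + b) ≡ a + (suc k * a + suc (suc k) * b)
  shuffle = solve-∀

catalan : ℕ → ℕ
catalan j = (j + j) C j ∸ (j + j) C suc j

[j+1]*[2j]C[j+1]≡j*[2j]Cj : ∀ j → suc j * ((j + j) C suc j) ≡ j * ((j + j) C j)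
[j+1]*[2j]C[j+1]≡j*[2j]Cj zero    = refl
[j+1]*[2j]C[j+1]≡j*[2j]Cj (suc i) = begin
  suc (suc i) * (suc N C suc (suc i)) ≡⟨ [k+1]*[n+1]C[k+1]≡[n+1]*nCk N (suc i) ⟩
  suc N * (N C suc i)                 ≡⟨ cong (suc N *_) (C-sym i (suc i) refl) ⟨
  suc N * (N C i)                     ≡⟨ [k+1]*[n+1]C[k+1]≡[n+1]*nCk N i ⟨
  suc i * (suc N C suc i)             ∎
  where
  N : ℕ
  N = i + suc i

[j+1]*catalan≡[2j]Cj : ∀ j → suc j * catalan j ≡ (j + j) C j
[j+1]*catalan≡[2j]Cj j = begin
  suc j * (A ∸ (j + j) C suc j)          ≡⟨ *-distribˡ-∸ (suc j) A ((j + j) C suc j) ⟩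
  suc j * A ∸ suc j * ((j + j) C suc j)  ≡⟨ cong (suc j * A ∸_) ([j+1]*[2j]C[j+1]≡j*[2j]Cj j) ⟩
  A + j * A ∸ j * A                      ≡⟨ m+n∸n≡m A (j * A) ⟩
  A                                      ∎
  where
  A : ℕ
  A = (j + j) C j

[2j+2]C[j+1]≡[4j+2]*catalan : ∀ j → (2 * suc j) C suc j ≡ (2 + 4 * j) * catalan j
[2j+2]C[j+1]≡[4j+2]*catalan j = *-cancelˡ-≡ _ _ (suc j) (*-cancelˡ-≡ _ _ (suc j) (begin
  suc j * (suc j * ((2 * suc j) C suc j))
    ≡⟨ cong (λ n → suc j * (suc j * (n C suc j))) (cong (suc j +_) (+-identityʳ (suc j))) ⟩
  suc j * (suc j * (suc N C suc j))
    ≡⟨ cong (suc j *_) ([k+1]*[n+1]C[k+1]≡[n+1]*nCk N j) ⟩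
  suc j * (suc N * (N C j))
    ≡⟨ cong (λ c → suc j * (suc N * c)) (C-sym j (suc j) refl) ⟩
  suc j * (suc N * (N C suc j))
    ≡⟨ x∙yz≈y∙xz (suc j) (suc N) (N C suc j) ⟩
  suc N * (suc j * (N C suc j))
    ≡⟨ cong (λ n → suc N * (suc j * (n C suc j))) (+-suc j j) ⟩
  suc N * (suc j * (suc (j + j) C suc j))
    ≡⟨ cong (suc N *_) ([k+1]*[n+1]C[k+1]≡[n+1]*nCk (j + j) j) ⟩
  suc N * (suc (j + j) * ((j + j) C j))
    ≡⟨ cong (λ c → suc N * (suc (j + j) * c)) ([j+1]*catalan≡[2j]Cj j) ⟨
  suc N * (suc (j + j) * (suc j * catalan j))
    ≡⟨ rearrange j (catalan j) ⟩
  suc j * (suc j * ((2 + 4 * j) * catalan j)) ∎))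
  where
  N : ℕ
  N = j + suc j
  rearrange : ∀ j c → suc (j + suc j) * (suc (j + j) * (suc j * c)) ≡ suc j * (suc j * ((2 + 4 * j) * c))
  rearrange = solve-∀

sum₁-scale : ∀ n c {f g : ℕ → ℕ} → (∀ j → suc j ≤ n → f (suc j) ≡ c * g (suc j)) →
             sum₁ n f ≡ c * sum₁ n g
sum₁-scale zero    c         _   = sym (*-zeroʳ c)
sum₁-scale (suc n) c {f} {g} f≡cg = begin
  sum₁ n f + f (suc n)
    ≡⟨ cong₂ _+_ (sum₁-scale n c (λ j j<n → f≡cg j (m≤n⇒m≤1+n j<n))) (f≡cg n ≤-refl) ⟩
  c * sum₁ n g + c * g (suc n)
    ≡⟨ *-distribˡ-+ c (sum₁ n g) (g (suc n)) ⟨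
  c * (sum₁ n g + g (suc n)) ∎

summand≡catalan : ∀ m n j →
                  summand m n (suc j) ≡ m ^ (1 + 2 * (n ∸ suc j)) * (m ∸ 1) ^ suc j * catalan j
summand≡catalan m n j = begin
  (a * ((2 * suc j) C suc j)) / (2 + 4 * j)
    ≡⟨ cong (λ c → (a * c) / (2 + 4 * j)) ([2j+2]C[j+1]≡[4j+2]*catalan j) ⟩
  (a * ((2 + 4 * j) * catalan j)) / (2 + 4 * j)
    ≡⟨ cong (_/ (2 + 4 * j)) (x∙yz≈xz∙y a (2 + 4 * j) (catalan j)) ⟩
  (a * catalan j * (2 + 4 * j)) / (2 + 4 * j)
    ≡⟨ m*n/n≡m (a * catalan j) (2 + 4 * j) ⟩
  a * catalan j ∎
  where
  a : ℕ
  a = m ^ (1 + 2 * (n ∸ suc j)) * (m ∸ 1) ^ suc j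

summand-suc : ∀ m n j → suc j ≤ n → summand m (suc n) (suc j) ≡ m * m * summand m n (suc j)
summand-suc m n j j<n = begin
  summand m (suc n) (suc j)           ≡⟨ summand≡catalan m (suc n) j ⟩
  m ^ (1 + 2 * (n ∸ j)) * p * c       ≡⟨ cong (λ t → m ^ (1 + 2 * t) * p * c) (+-∸-assoc 1 j<n) ⟩
  m ^ (1 + 2 * suc t) * p * c         ≡⟨ cong (λ e → m ^ e * p * c) (exponent t) ⟩
  m * (m * m ^ (1 + 2 * t)) * p * c   ≡⟨ reassociate m (m ^ (1 + 2 * t)) p c ⟩
  m * m * (m ^ (1 + 2 * t) * p * c)   ≡⟨ cong (m * m *_) (summand≡catalan m n j) ⟨
  m * m * summand m n (suc j)         ∎
  where
  t : ℕ
  t = n ∸ suc j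
  p : ℕ
  p = (m ∸ 1) ^ suc j
  c : ℕ
  c = catalan j
  exponent : ∀ t → 1 + 2 * suc t ≡ 2 + (1 + 2 * t)
  exponent = solve-∀
  reassociate : ∀ m a p c → m * (m * a) * p * c ≡ m * m * (a * p * c)
  reassociate = solve-∀

summand-last : ∀ m n → summand m (suc n) (suc n) ≡ m * (m ∸ 1) ^ suc n * catalan n
summand-last m n = begin
  summand m (suc n) (suc n)                    ≡⟨ summand≡catalan m (suc n) n ⟩
  m ^ (1 + 2 * (n ∸ n)) * (m ∸ 1) ^ suc n * c  ≡⟨ cong (λ t → m ^ (1 + 2 * t) * (m ∸ 1) ^ suc n * c) (n∸n≡0 n) ⟩
  m * 1 * (m ∸ 1) ^ suc n * c                  ≡⟨ cong (λ a → a * (m ∸ 1) ^ suc n * c) (*-identityʳ m) ⟩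
  m * (m ∸ 1) ^ suc n * c                      ∎
  where
  c : ℕ
  c = catalan n

Fin-cong : ∀ {m n} → m ≡ n → Fin m ↔ Fin n
Fin-cong refl = ↔-refl

Σ-Fin↔Fin-sum : ∀ {n} (f : Fin n → ℕ) → Σ (Fin n) (Fin ∘ f) ↔ Fin (sum f)
Σ-Fin↔Fin-sum {zero}  f = mk↔ₛ′ (λ ()) (λ ()) (λ ()) (λ ())
Σ-Fin↔Fin-sum {suc n} f =
  ↔-trans split (↔-trans (↔-refl ⊎-↔ Σ-Fin↔Fin-sum (f ∘ suc)) (↔-sym (+↔⊎ {f zero})))
  where
  split : Σ (Fin (suc n)) (Fin ∘ f) ↔ (Fin (f zero) ⊎ Σ (Fin n) (Fin ∘ f ∘ suc))
  split = mk↔ₛ′ (λ { (zero , x) → inj₁ x ; (suc a , x) → inj₂ (a , x) })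
                (λ { (inj₁ x) → zero , x ; (inj₂ (a , x)) → suc a , x })
                (λ { (inj₁ _) → refl ; (inj₂ _) → refl })
                (λ { (zero , _) → refl ; (suc _ , _) → refl })

sum-const : ∀ n c → sum {n} (λ _ → c) ≡ n * c
sum-const zero    c = refl
sum-const (suc n) c = cong (c +_) (sum-const n c)

sum-single-out : ∀ {n} (f : Fin (suc n) → ℕ) b {c} → (∀ a → a ≢ b → f a ≡ c) → sum f ≡ f b + n * c
sum-single-out {n} f b {c} others = begin
  sum f                      ≡⟨ sum-remove {i = b} f ⟩
  f b + sum (f ∘ punchIn b)  ≡⟨ cong (f b +_) (sum-cong-≗ (λ a → others (punchIn b a) (punchInᵢ≢i b a))) ⟩
  f b + sum {n} (λ _ → c)    ≡⟨ cong (f b +_) (sum-const n c) ⟩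
  f b + n * c                ∎

module CayleyTree (m : ℕ) where

  private variable
    a b : Fin m

  infixr 5 _∙_

  _∙_ : Fin m → List (Fin m) → List (Fin m)
  a ∙ []      = a ∷ []
  a ∙ (b ∷ w) with a ≟ b
  ... | yes _ = w
  ... | no  _ = a ∷ b ∷ w

  reduced-tail : ∀ w → T (reduced (a ∷ w)) → T (reduced w)
  reduced-tail         []      _ = tt
  reduced-tail {a = a} (b ∷ w) r with a ≟ b
  ... | no _ = r

  reduced-head : ∀ w → T (reduced (a ∷ b ∷ w)) → a ≢ b
  reduced-head {a} {b} w r with a ≟ b
  ... | no a≢b = a≢b

  reduced-∷ : ∀ w → a ≢ b → T (reduced (b ∷ w)) → T (reduced (a ∷ b ∷ w))
  reduced-∷ {a} {b} w a≢b r with a ≟ b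
  ... | yes a≡b = ⊥-elim (a≢b a≡b)
  ... | no  _   = r

  ∙-cancel : ∀ a w → a ∙ (a ∷ w) ≡ w
  ∙-cancel a w with a ≟ a
  ... | yes _   = refl
  ... | no  a≢a = ⊥-elim (a≢a refl)

  ∙-extend : ∀ w → a ≢ b → a ∙ (b ∷ w) ≡ a ∷ b ∷ w
  ∙-extend {a} {b} w a≢b with a ≟ b
  ... | yes a≡b = ⊥-elim (a≢b a≡b)
  ... | no  _   = refl

  reduced-∙ : ∀ a w → T (reduced w) → T (reduced (a ∙ w))
  reduced-∙ a []      _ = tt
  reduced-∙ a (b ∷ w) r with a ≟ b
  ... | yes _   = reduced-tail w r
  ... | no  a≢b = reduced-∷ w a≢b r

  ∙-involutive : ∀ a w → T (reduced w) → a ∙ a ∙ w ≡ w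
  ∙-involutive a []      _ = ∙-cancel a []
  ∙-involutive a (b ∷ w) r with a ≟ b
  ∙-involutive a (b ∷ [])    _ | yes refl = refl
  ∙-involutive a (b ∷ c ∷ w) r | yes refl = ∙-extend w (reduced-head w r)
  ... | no _ = ∙-cancel a (b ∷ w)

  w≢a∷b∷w : ∀ {w : List (Fin m)} → w ≢ a ∷ b ∷ w
  w≢a∷b∷w {w = w} eq = m≢1+n+m (length w) (cong length eq)

  ∙-injective : ∀ w {a b} → a ∙ w ≡ b ∙ w → a ≡ b
  ∙-injective []      refl = refl
  ∙-injective (c ∷ w) {a} {b} eq with a ≟ c | b ≟ c
  ... | yes refl | yes refl = refl
  ... | yes _    | no  _    = ⊥-elim (w≢a∷b∷w eq)
  ... | no  _    | yes _    = ⊥-elim (w≢a∷b∷w (sym eq))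
  ... | no  _    | no  _    = ∷-injectiveˡ eq

  ∙-extend-reduced : ∀ w → T (reduced (a ∷ w)) → a ∙ w ≡ a ∷ w
  ∙-extend-reduced []      _ = refl
  ∙-extend-reduced (b ∷ w) r = ∙-extend w (reduced-head w r)

  child-adjacent : ∀ (a : Fin m) w → T (adjWord w (a ∷ w))
  child-adjacent a w =
    Equivalence.from (T-∨ {isChild (a ∷ w) w} {isChild w (a ∷ w)})
                     (inj₁ (fromWitness {a? = ≡-dec _≟_ w w} refl))

  parent-adjacent : ∀ (a : Fin m) w → T (adjWord (a ∷ w) w)
  parent-adjacent a w =
    Equivalence.from (T-∨ {isChild w (a ∷ w)} {isChild (a ∷ w) w})
                     (inj₂ (fromWitness {a? = ≡-dec _≟_ w w} refl))

  isChild⇒≡ : ∀ (a : Fin m) y x → T (isChild (a ∷ y) x) → y ≡ x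
  isChild⇒≡ _ y x = toWitness {a? = ≡-dec _≟_ y x}

  adjacent-∙ : ∀ a w → T (adjWord w (a ∙ w))
  adjacent-∙ a []      = child-adjacent a []
  adjacent-∙ a (b ∷ w) with a ≟ b
  ... | yes _ = parent-adjacent b w
  ... | no  _ = child-adjacent a (b ∷ w)

  adjacent⇒∙ : ∀ x y → T (reduced y) → T (adjWord x y) → ∃[ a ] a ∙ x ≡ y
  adjacent⇒∙ x y r adj with Equivalence.to (T-∨ {isChild y x} {isChild x y}) adj
  adjacent⇒∙ x []      r _ | inj₁ ()
  adjacent⇒∙ x (a ∷ y) r _ | inj₁ y-child with isChild⇒≡ a y x y-child
  ... | refl = a , ∙-extend-reduced x r
  adjacent⇒∙ []      y r _ | inj₂ ()
  adjacent⇒∙ (a ∷ x) y r _ | inj₂ x-child with isChild⇒≡ a x y x-child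
  ... | refl = a , ∙-cancel a x

  _∙ᵛ_ : Fin m → Vertex m → Vertex m
  a ∙ᵛ (w , r) = a ∙ w , reduced-∙ a w r

  vertex-≡ : {x y : Vertex m} → proj₁ x ≡ proj₁ y → x ≡ y
  vertex-≡ {w , r} {.w , r′} refl = cong (w ,_) (T-irrelevant r r′)

  Neighbour : Vertex m → Set
  Neighbour x = Σ (Vertex m) (Adj x)

  neighbour-≡ : {x : Vertex m} {y z : Neighbour x} → proj₁ (proj₁ y) ≡ proj₁ (proj₁ z) → y ≡ z
  neighbour-≡ {y = (w , r) , e} {(.w , r′) , e′} refl
    rewrite T-irrelevant r r′ | T-irrelevant e e′ = refl

  Fin↔Neighbour : (x : Vertex m) → Fin m ↔ Neighbour x
  Fin↔Neighbour (w , r) = mk↔ₛ′ to from to∘from from∘to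
    where
    to : Fin m → Neighbour (w , r)
    to a = a ∙ᵛ (w , r) , adjacent-∙ a w
    from : Neighbour (w , r) → Fin m
    from ((y , r′) , adj) = proj₁ (adjacent⇒∙ w y r′ adj)
    to∘from : ∀ y → to (from y) ≡ y
    to∘from ((w′ , r′) , adj) = neighbour-≡ {w , r} (proj₂ (adjacent⇒∙ w w′ r′ adj))
    from∘to : ∀ a → from (to a) ≡ a
    from∘to a = ∙-injective w (proj₂ (adjacent⇒∙ w (a ∙ w) (reduced-∙ a w r) (adjacent-∙ a w)))

  Walk-zero↔ : {x z : Vertex m} → Walk x 0 z ↔ (x ≡ z)
  Walk-zero↔ = mk↔ₛ′ (λ { stop → refl }) (λ { refl → stop }) (λ { refl → refl }) (λ { stop → refl })

  Walk-suc↔ : ∀ {x z : Vertex m} {k} → Walk x (suc k) z ↔ Σ (Fin m) (λ a → Walk (a ∙ᵛ x) k z)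
  Walk-suc↔ {x} {z} {k} = ↔-trans first-step (↔-sym (Σ-↔ (Fin↔Neighbour x) ↔-refl))
    where
    first-step : Walk x (suc k) z ↔ Σ (Neighbour x) (λ y → Walk (proj₁ y) k z)
    first-step = mk↔ₛ′ (λ { (step adj w) → (_ , adj) , w }) (λ { ((_ , adj) , w) → step adj w })
                       (λ _ → refl) (λ { (step _ _) → refl })

  infixr 5 _⋆_

  _⋆_ : List (Fin m) → List (Fin m) → List (Fin m)
  x ⋆ u = foldr _∙_ u x

  reduced-⋆ : ∀ x {u} → T (reduced u) → T (reduced (x ⋆ u))
  reduced-⋆ []      r = r
  reduced-⋆ (a ∷ x) r = reduced-∙ a (x ⋆ _) (reduced-⋆ x r)

  ∙-⋆ : ∀ a x {u} → T (reduced u) → (a ∙ x) ⋆ u ≡ a ∙ (x ⋆ u)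
  ∙-⋆ a []      r = refl
  ∙-⋆ a (b ∷ x) r with a ≟ b
  ... | yes refl = sym (∙-involutive a (x ⋆ _) (reduced-⋆ x r))
  ... | no  _    = refl

  ⋆-ʳ++ : ∀ x t → x ⋆ (x ʳ++ t) ≡ t
  ⋆-ʳ++ []      t = refl
  ⋆-ʳ++ (a ∷ x) t = trans (cong (a ∙_) (⋆-ʳ++ x (a ∷ t))) (∙-cancel a t)

  ⋆-injective : ∀ x {u u′} → T (reduced u) → T (reduced u′) → x ⋆ u ≡ x ⋆ u′ → u ≡ u′
  ⋆-injective []      _ _  eq = eq
  ⋆-injective (a ∷ x) {u} {u′} r r′ eq = ⋆-injective x r r′ (begin
    x ⋆ u              ≡⟨ ∙-involutive a (x ⋆ u) (reduced-⋆ x r) ⟨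
    a ∙ a ∙ (x ⋆ u)    ≡⟨ cong (a ∙_) eq ⟩
    a ∙ a ∙ (x ⋆ u′)   ≡⟨ ∙-involutive a (x ⋆ u′) (reduced-⋆ x r′) ⟩
    x ⋆ u′             ∎)

  reduced-ʳ++ : ∀ x t → T (reduced (a ∷ x)) → T (reduced (a ∷ t)) → T (reduced (x ʳ++ a ∷ t))
  reduced-ʳ++ []      t _ r′ = r′
  reduced-ʳ++ (b ∷ x) t r r′ =
    reduced-ʳ++ x (_ ∷ t) (reduced-tail (b ∷ x) r) (reduced-∷ t (reduced-head x r ∘ sym) r′)

  reduced-reverse : ∀ x → T (reduced x) → T (reduced (reverse x))
  reduced-reverse []      _ = tt
  reduced-reverse (a ∷ x) r = reduced-ʳ++ x [] r tt

  vertex-≟ : DecidableEquality (Vertex m)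
  vertex-≟ x y = map′ vertex-≡ (cong proj₁) (≡-dec _≟_ (proj₁ x) (proj₁ y))

module WalkCounts (q : ℕ) where

  walks : ℕ → ℕ → ℕ
  walks zero    zero    = 1
  walks zero    (suc d) = 0
  walks (suc k) zero    = suc q * walks k 1
  walks (suc k) (suc d) = walks k d + q * walks k (2 + d)

  rootedWalks : ℕ → ℕ → ℕ
  rootedWalks zero    zero    = 1
  rootedWalks zero    (suc d) = 0
  rootedWalks (suc k) zero    = q * rootedWalks k 1
  rootedWalks (suc k) (suc d) = rootedWalks k d + q * rootedWalks k (2 + d)

  walks≡walks₊₂+rootedWalks : ∀ k d → walks k d ≡ walks k (2 + d) + rootedWalks k d
  walks≡walks₊₂+rootedWalks zero    zero    = refl
  walks≡walks₊₂+rootedWalks zero    (suc d) = refl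
  walks≡walks₊₂+rootedWalks (suc k) zero
    rewrite walks≡walks₊₂+rootedWalks k 1 = rearrange q (walks k 3) (rootedWalks k 1)
    where
    rearrange : ∀ q a b → suc q * (a + b) ≡ (a + b + q * a) + q * b
    rearrange = solve-∀
  walks≡walks₊₂+rootedWalks (suc k) (suc d)
    rewrite walks≡walks₊₂+rootedWalks k d | walks≡walks₊₂+rootedWalks k (2 + d) =
      rearrange q (walks k (4 + d)) (rootedWalks k d) (rootedWalks k (2 + d))
    where
    rearrange : ∀ q a b c → (a + c + b) + q * (a + c) ≡ (a + c + q * a) + (b + q * c)
    rearrange = solve-∀

  rootedWalks-vanish : ∀ {k d} → k < d → rootedWalks k d ≡ 0
  rootedWalks-vanish {zero}  {suc d} _         = refl
  rootedWalks-vanish {suc k} {suc d} (s≤s k<d)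
    rewrite rootedWalks-vanish k<d | rootedWalks-vanish {k} {2 + d} (m<n⇒m<1+n (m<n⇒m<1+n k<d)) = *-zeroʳ q

  rootedWalks-diag : ∀ d → rootedWalks d d ≡ 1
  rootedWalks-diag zero = refl
  rootedWalks-diag (suc d)
    rewrite rootedWalks-diag d | rootedWalks-vanish {d} {2 + d} (m<n⇒m<1+n (n<1+n d)) = cong suc (*-zeroʳ q)

  -- The ballot formula: such a walk makes u steps away from the root, each in one of q ways.
  rootedWalks-ballot : ∀ u d k → k ≡ u + u + d →
                       rootedWalks k d + q ^ u * (k C suc (d + u)) ≡ q ^ u * (k C u)
  rootedWalks-ballot zero    d       k       refl =
    cong₂ (λ e c → e + 1 * c) (rootedWalks-diag k) (k>n⇒nCk≡0 (s≤s (m≤m+n k 0)))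
  rootedWalks-ballot (suc u) zero    (suc k) eq = begin
    q * rootedWalks k 1 + Q * (suc k C suc (suc u))
      ≡⟨ cong (λ c → q * rootedWalks k 1 + Q * c) (nCk+nC[k+1]≡[n+1]C[k+1] k (suc u)) ⟨
    q * rootedWalks k 1 + Q * (k C suc u + k C suc (suc u))
      ≡⟨ rearrange q (q ^ u) (rootedWalks k 1) (k C suc u) (k C suc (suc u)) ⟩
    q * (rootedWalks k 1 + q ^ u * (k C suc (suc u))) + Q * (k C suc u)
      ≡⟨ cong (λ c → q * c + Q * (k C suc u)) (rootedWalks-ballot u 1 k (trans (suc-injective eq) (index u))) ⟩
    q * (q ^ u * (k C u)) + Q * (k C suc u)
      ≡⟨ distribute q (q ^ u) (k C u) (k C suc u) ⟩
    Q * (k C u + k C suc u)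
      ≡⟨ cong (Q *_) (nCk+nC[k+1]≡[n+1]C[k+1] k u) ⟩
    Q * (suc k C suc u) ∎
    where
    Q : ℕ
    Q = q ^ suc u
    index : ∀ u → u + suc u + 0 ≡ u + u + 1
    index = solve-∀
    rearrange : ∀ q p e a b → q * e + q * p * (a + b) ≡ q * (e + p * b) + q * p * a
    rearrange = solve-∀
    distribute : ∀ q p c a → q * (p * c) + q * p * a ≡ q * p * (c + a)
    distribute = solve-∀
  rootedWalks-ballot (suc u) (suc d) (suc k) eq = begin
    rootedWalks k d + q * rootedWalks k (2 + d) + Q * (suc k C suc (suc (d + suc u)))
      ≡⟨ cong (λ c → rootedWalks k d + q * rootedWalks k (2 + d) + Q * c)
              (nCk+nC[k+1]≡[n+1]C[k+1] k (suc (d + suc u))) ⟨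
    rootedWalks k d + q * rootedWalks k (2 + d) + Q * (k C suc (d + suc u) + k C suc (suc (d + suc u)))
      ≡⟨ cong (λ i → rootedWalks k d + q * rootedWalks k (2 + d) + Q * (k C suc (d + suc u) + k C suc (suc i)))
              (+-suc d u) ⟩
    rootedWalks k d + q * rootedWalks k (2 + d) + Q * (k C suc (d + suc u) + k C suc (2 + d + u))
      ≡⟨ rearrange q (q ^ u) (rootedWalks k d) (rootedWalks k (2 + d)) (k C suc (d + suc u)) (k C suc (2 + d + u)) ⟩
    (rootedWalks k d + Q * (k C suc (d + suc u))) + q * (rootedWalks k (2 + d) + q ^ u * (k C suc (2 + d + u)))
      ≡⟨ cong₂ (λ a b → a + q * b) (rootedWalks-ballot (suc u) d k (trans (suc-injective eq) (index₁ u d)))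
                                   (rootedWalks-ballot u (2 + d) k (trans (suc-injective eq) (index₂ u d))) ⟩
    Q * (k C suc u) + q * (q ^ u * (k C u))
      ≡⟨ distribute q (q ^ u) (k C u) (k C suc u) ⟩
    Q * (k C u + k C suc u)
      ≡⟨ cong (Q *_) (nCk+nC[k+1]≡[n+1]C[k+1] k u) ⟩
    Q * (suc k C suc u) ∎
    where
    Q : ℕ
    Q = q ^ suc u
    index₁ : ∀ u d → u + suc u + suc d ≡ suc u + suc u + d
    index₁ = solve-∀
    index₂ : ∀ u d → u + suc u + suc d ≡ u + u + (2 + d)
    index₂ = solve-∀
    rearrange : ∀ q p e f a b → e + q * f + q * p * (a + b) ≡ (e + q * p * a) + q * (f + p * b)
    rearrange = solve-∀
    distribute : ∀ q p c a → q * p * a + q * (p * c) ≡ q * p * (c + a)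
    distribute = solve-∀

  rootedWalks-catalan : ∀ j → rootedWalks (2 * j) 0 ≡ q ^ j * catalan j
  rootedWalks-catalan j = begin
    rootedWalks (2 * j) 0
      ≡⟨ m+n∸n≡m (rootedWalks (2 * j) 0) (q ^ j * (A C suc j)) ⟨
    rootedWalks (2 * j) 0 + q ^ j * (A C suc j) ∸ q ^ j * (A C suc j)
      ≡⟨ cong (_∸ q ^ j * (A C suc j)) (rootedWalks-ballot j 0 (2 * j) (sym (+-assoc j j 0))) ⟩
    q ^ j * (A C j) ∸ q ^ j * (A C suc j)
      ≡⟨ cong (λ n → q ^ j * (n C j) ∸ q ^ j * (n C suc j)) (cong (j +_) (+-identityʳ j)) ⟩
    q ^ j * ((j + j) C j) ∸ q ^ j * ((j + j) C suc j)
      ≡⟨ *-distribˡ-∸ (q ^ j) ((j + j) C j) ((j + j) C suc j) ⟨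
    q ^ j * catalan j ∎
    where
    A : ℕ
    A = 2 * j

  walks-return : ∀ k → walks (2 + k) 0 + suc q * q * rootedWalks k 0 ≡ suc q * suc q * walks k 0
  walks-return k = begin
    suc q * (walks k 0 + q * walks k 2) + suc q * q * rootedWalks k 0
      ≡⟨ cong (λ w → suc q * (w + q * walks k 2) + suc q * q * rootedWalks k 0) (walks≡walks₊₂+rootedWalks k 0) ⟩
    suc q * (walks k 2 + rootedWalks k 0 + q * walks k 2) + suc q * q * rootedWalks k 0
      ≡⟨ rearrange q (walks k 2) (rootedWalks k 0) ⟩
    suc q * suc q * (walks k 2 + rootedWalks k 0)
      ≡⟨ cong (suc q * suc q *_) (walks≡walks₊₂+rootedWalks k 0) ⟨
    suc q * suc q * walks k 0 ∎
    where
    rearrange : ∀ q w e → suc q * (w + e + q * w) + suc q * q * e ≡ suc q * suc q * (w + e)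
    rearrange = solve-∀

  summand-last≡rootedWalks : ∀ n → summand (suc q) (suc n) (suc n) ≡ suc q * q * rootedWalks (2 * n) 0
  summand-last≡rootedWalks n = begin
    summand (suc q) (suc n) (suc n)  ≡⟨ summand-last (suc q) n ⟩
    suc q * (q * q ^ n) * catalan n  ≡⟨ reassociate (suc q) q (q ^ n) (catalan n) ⟩
    suc q * q * (q ^ n * catalan n)  ≡⟨ cong (suc q * q *_) (rootedWalks-catalan n) ⟨
    suc q * q * rootedWalks (2 * n) 0 ∎
    where
    reassociate : ∀ m q a c → m * (q * a) * c ≡ m * q * (a * c)
    reassociate = solve-∀

  walks+summands≡power : ∀ n → walks (2 * n) 0 + sum₁ n (summand (suc q) n) ≡ suc q ^ (2 * n)
  walks+summands≡power zero    = refl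
  walks+summands≡power (suc n) = begin
    walks (2 * suc n) 0 + (sum₁ n (summand m (suc n)) + summand m (suc n) (suc n))
      ≡⟨ cong (λ k → walks k 0 + sum₁ (suc n) (summand m (suc n))) (*-suc 2 n) ⟩
    walks (2 + 2 * n) 0 + (sum₁ n (summand m (suc n)) + summand m (suc n) (suc n))
      ≡⟨ cong₂ (λ s t → walks (2 + 2 * n) 0 + (s + t))
               (sum₁-scale n (m * m) (summand-suc m n)) (summand-last≡rootedWalks n) ⟩
    walks (2 + 2 * n) 0 + (m * m * S + m * q * rootedWalks (2 * n) 0)
      ≡⟨ x+[y+z]≡x+z+y (walks (2 + 2 * n) 0) (m * m * S) (m * q * rootedWalks (2 * n) 0) ⟩
    walks (2 + 2 * n) 0 + m * q * rootedWalks (2 * n) 0 + m * m * S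
      ≡⟨ cong (_+ m * m * S) (walks-return (2 * n)) ⟩
    m * m * walks (2 * n) 0 + m * m * S
      ≡⟨ *-distribˡ-+ (m * m) (walks (2 * n) 0) S ⟨
    m * m * (walks (2 * n) 0 + S)
      ≡⟨ cong (m * m *_) (walks+summands≡power n) ⟩
    m * m * m ^ (2 * n)
      ≡⟨ *-assoc m m (m ^ (2 * n)) ⟩
    m ^ (2 + 2 * n)
      ≡⟨ cong (m ^_) (*-suc 2 n) ⟨
    m ^ (2 * suc n) ∎
    where
    m : ℕ
    m = suc q
    S : ℕ
    S = sum₁ n (summand m n)
    x+[y+z]≡x+z+y : ∀ x y z → x + (y + z) ≡ x + z + y
    x+[y+z]≡x+z+y = solve-∀

  walks≡formula : ∀ n → walks (2 * n) 0 ≡ formula (suc q) n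
  walks≡formula n = begin
    walks (2 * n) 0          ≡⟨ m+n∸n≡m (walks (2 * n) 0) S ⟨
    walks (2 * n) 0 + S ∸ S  ≡⟨ cong (_∸ S) (walks+summands≡power n) ⟩
    suc q ^ (2 * n) ∸ S      ∎
    where
    S : ℕ
    S = sum₁ n (summand (suc q) n)

module ClosedWalkCount (q : ℕ) where
  open CayleyTree (suc q)
  open WalkCounts q

  sum-walks-∙ : ∀ k r → sum (λ a → walks k (length (a ∙ r))) ≡ walks (suc k) (length r)
  sum-walks-∙ k []      = sum-const (suc q) (walks k 1)
  sum-walks-∙ k (b ∷ r) =
    trans (sum-single-out (λ a → walks k (length (a ∙ b ∷ r))) b
                          (λ a a≢b → cong (walks k ∘ length) (∙-extend r a≢b)))
          (cong (λ w → walks k (length w) + q * walks k (2 + length r)) (∙-cancel b r))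

  module _ (v : Vertex (suc q)) where

    -- offset x is the word x v⁻¹ (a reduced word is inverted by reversing it),
    -- so its length is the distance from x to v.
    offset : List (Fin (suc q)) → List (Fin (suc q))
    offset x = x ⋆ reverse (proj₁ v)

    reduced-v⁻¹ : T (reduced (reverse (proj₁ v)))
    reduced-v⁻¹ = reduced-reverse (proj₁ v) (proj₂ v)

    offset-∙ : ∀ a x → offset (a ∙ x) ≡ a ∙ offset x
    offset-∙ a x = ∙-⋆ a x reduced-v⁻¹

    offset-self : offset (proj₁ v) ≡ []
    offset-self = ⋆-ʳ++ (proj₁ v) []

    offset≡[]⇒≡ : ∀ x → offset (proj₁ x) ≡ [] → x ≡ v
    offset≡[]⇒≡ (x , r) eq = vertex-≡ (sym (reverse-injective
      (⋆-injective x reduced-v⁻¹ (reduced-reverse x r) (trans eq (sym (⋆-ʳ++ x []))))))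

    ≡↔Fin-walks₀ : ∀ x → (x ≡ v) ↔ Fin (walks 0 (length (offset (proj₁ x))))
    ≡↔Fin-walks₀ x with offset (proj₁ x) in eq
    ... | []    = mk↔ₛ′ (λ _ → zero) (λ _ → offset≡[]⇒≡ x eq) (λ { zero → refl })
                        (λ _ → UIP.Decidable⇒UIP.≡-irrelevant vertex-≟ _ _)
    ... | _ ∷ _ = mk↔ₛ′ (⊥-elim ∘ x≢v) (λ ()) (λ ()) (⊥-elim ∘ x≢v)
      where
      x≢v : x ≢ v
      x≢v refl with trans (sym offset-self) eq
      ... | ()

    Walk↔Fin-walks : ∀ k x → Walk x k v ↔ Fin (walks k (length (offset (proj₁ x))))
    Walk↔Fin-walks zero    x = ↔-trans Walk-zero↔ (≡↔Fin-walks₀ x)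
    Walk↔Fin-walks (suc k) x =
      ↔-trans Walk-suc↔ (↔-trans (Σ-↔ ↔-refl (λ {a} → Walk↔Fin-walks k (a ∙ᵛ x)))
                        (↔-trans (Σ-Fin↔Fin-sum _) (Fin-cong count)))
      where
      count : sum (λ a → walks k (length (offset (a ∙ proj₁ x)))) ≡ walks (suc k) (length (offset (proj₁ x)))
      count = trans (sum-cong-≗ (λ a → cong (walks k ∘ length) (offset-∙ a (proj₁ x))))
                    (sum-walks-∙ k (offset (proj₁ x)))

    ClosedWalk↔Fin-walks : ∀ n → ClosedWalk (suc q) v n ↔ Fin (walks (2 * n) 0)
    ClosedWalk↔Fin-walks n =
      ↔-trans (Walk↔Fin-walks (2 * n) v) (Fin-cong (cong (walks (2 * n) ∘ length) offset-self))

mainTheorem1 : (m n : ℕ) → 2 ≤ m → 1 ≤ n → (v : Vertex m) →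
    ClosedWalk m v n ↔ Fin (formula m n)
mainTheorem1 zero    n () _ _
mainTheorem1 (suc q) n _  _ v =
  ↔-trans (ClosedWalk↔Fin-walks v n) (Fin-cong (walks≡formula n))
  where
  open WalkCounts q
  open ClosedWalkCount q
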